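{- For any type expression $E$, $etype(E)=\mathit{true}$ if and only if $\mathrm{Empty}(E)$, i.e. $[\![E]\!]_{\Delta}=\emptyset$.
   Context: $\Sigma$ is a finite ranked alphabet of function symbols containing at least one constant; $\mathcal{T}(\Sigma)$ is the set of ground terms over $\Sigma$. $\Pi$ is a finite ranked alphabet of type constructors, disjoint from $\Sigma$ and from $\{\sqcap,\sqcup,\neg,\top,\bot\}$. A type expression is a ground term over $\Pi\cup\{\sqcap,\sqcup,\neg,\top,\bot\}$. $\Delta$ is a finite set of type rules $c(\zeta_1,\dots,\zeta_m)\rightarrow\tau$ with $c\in\Pi$ of arity $m$, distinct parameters $\zeta_i$, and $\tau$ of the form $f(\tau_1,\dots,\tau_n)$, $f\in\Sigma$, each $\tau_j$ either some $\zeta_i$ or $d(\zeta'_1,\dots,\zeta'_k)$ with $d\in\Pi$ and $\zeta'_i\in\{\zeta_1,\dots,\zeta_m\}$. $ground(\Delta)$ is the set of all instances of rules of $\Delta$ obtained by substituting type expressions for parameters, together with $\top\rightarrow f(\top,\dots,\top)$ for every $f\in\Sigma$. The meaning: $[\![\top]\!]_\Delta=\mathcal{T}(\Sigma)$, $[\![\bot]\!]_\Delta=\emptyset$, $\sqcap,\sqcup,\neg$ are intersection, union, complement w.r.t. $\mathcal{T}(\Sigma)$, and for a type atom $\omega$ (a type expression whose principal symbol is in $\Pi$), $[\![\omega]\!]_\Delta=\bigcup_{(\omega\rightarrow f(E_1,\dots,E_n))\in ground(\Delta)}\{f(t_1,\dots,t_n)\mid t_i\in[\![E_i]\!]_\Delta\}$.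 On sequences: $[\![\epsilon]\!]=\{\epsilon\}$, $[\![\langle E\rangle\bullet\theta]\!]=[\![E]\!]\times[\![\theta]\!]$, and a special sequence $\Lambda$ has $[\![\Lambda]\!]=\emptyset$; sequence expressions combine equal-length sequences with $\sqcap,\sqcup,\neg$ (set operations on tuples of terms); a conjunctive sequence expression is $\gamma_1\sqcap\dots\sqcap\gamma_k$ of sequences, with length $\|\Gamma\|$, and $\Gamma|_j=\gamma_1^j\sqcap\dots\sqcap\gamma_k^j$ ($\gamma_i^j$ the $j$-th component). $\mathrm{Empty}(O)$ means $[\![O]\!]_\Delta=\emptyset$. A literal is a type atom or its complement; a conjunctive type expression $C$ is an intersection of literals (without repetitions, containing at least one positive literal, e.g. $\top$); $pos(C)$, $neg(C)$ are its positive atoms and complemented atoms, $lit(C)$ its literals; $C_1\preceq C_2$ iff $lit(C_1)\supseteq lit(C_2)$. $\mathcal{F}(\alpha)=\{f\mid \exists (\alpha\rightarrow f(\dots))\in ground(\Delta)\}$, $\mathcal{A}^f_\alpha=\{\langle\alpha_1,\dots,\alpha_k\rangle\mid(\alpha\rightarrow f(\alpha_1,\dots,\alpha_k))\in ground(\Delta)\}$. $push(\neg(\sqcup_i\gamma_i))=\sqcap_i push(\neg\gamma_i)$, $push(\neg\langle E_1,\dots,E_k\rangle)=\sqcup_{l=1}^k\langle\top,\dots,\top,\neg E_l,\top,\dots,\top\rangle$ ($\neg E_l$ at position $l$), $push(\neg\epsilon)=\Lambda$. $\mathcal{B}^f_C=\big(\sqcap_{\omega\in pos(C)}(\sqcup\mathcal{A}^f_\omega)\big)\sqcap\big(\sqcap_{\tau\in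 neg(C)}push(\neg(\sqcup\mathcal{A}^f_\tau))\big)$. DNF denotes disjunctive normal form (set of disjuncts). The algorithm: $etype(E)=etype(E,\emptyset)$; $etype(E,\Psi)=\forall C\in DNF(E).\,etype\_conj(C,\Psi)$; $etype\_conj(C,\Psi)=\mathit{true}$ if $pos(C)\cap neg(C)\neq\emptyset$, $\mathit{true}$ if $\exists C'\in\Psi.\,C\preceq C'$, otherwise $\forall f\in\bigcap_{\alpha\in pos(C)}\mathcal{F}(\alpha).\,eseq(\mathcal{B}^f_C,\Psi\cup\{C\})$; $eseq(\Theta,\Psi)=\forall\Gamma\in DNF(\Theta).\,eseq\_conj(\Gamma,\Psi)$; $eseq\_conj(\Gamma,\Psi)$ is $\mathit{true}$ if $\|\Gamma\|=0$ and $\Lambda\in\Gamma$, $\mathit{false}$ if $\|\Gamma\|=0$ and $\Lambda\notin\Gamma$, and $\exists 1\le j\le\|\Gamma\|.\,etype(\Gamma|_j,\Psi)$ otherwise. -}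

module Defs where

open import Data.Nat using (ℕ; zero; suc)
open import Data.Fin using (Fin; zero; suc)
open import Data.Fin.Properties using () renaming (_≟_ to _≟ᶠ_)
open import Data.Vec using (Vec; []; _∷_; lookup; replicate; _[_]≔_)
import Data.Vec as Vec
open import Data.List using (List; []; _∷_; _++_; map; concatMap; cartesianProductWith; deduplicate; allFin)
open import Data.List.Relation.Unary.All using (All)
open import Data.List.Membership.Propositional using (_∈_)
open import Data.Product using (Σ; ∃; _×_; _,_; proj₁; proj₂)
open import Data.Sum using (_⊎_)
open import Data.Unit using (⊤; tt)
open import Data.Empty using (⊥)
open import Relation.Nullary using (¬_; Dec; yes; no)
open import Relation.Binary.Definitions using (DecidableEquality)
open import Relation.Binary.PropositionalEquality using (_≡_; refl; cong)

record RankedAlphabet : Set where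
  field
    size : ℕ
    ar   : Fin size → ℕ
open RankedAlphabet public

Sym : RankedAlphabet → Set
Sym A = Fin (size A)

HasConstant : RankedAlphabet → Set
HasConstant A = Σ (Sym A) λ f → ar A f ≡ 0

data Term (S : RankedAlphabet) : Set where
  app : (f : Sym S) → Vec (Term S) (ar S f) → Term S

infixr 7 _⊓_
infixr 6 _⊔_

data TExp (P : RankedAlphabet) : Set where
  atom : (c : Sym P) → Vec (TExp P) (ar P c) → TExp P
  _⊓_  : TExp P → TExp P → TExp P
  _⊔_  : TExp P → TExp P → TExp P
  ¬ᵗ_  : TExp P → TExp P
  ⊤ᵗ   : TExp P
  ⊥ᵗ   : TExp P

Atom : RankedAlphabet → Set
Atom P = Σ (Sym P) λ c → Vec (TExp P) (ar P c)

atomExp : ∀ {P} → Atom P → TExp P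
atomExp (c , σ) = atom c σ

module _ {P : RankedAlphabet} where
  private
    atom-inj : ∀ {c : Sym P} {v w : Vec (TExp P) (ar P c)} → atom c v ≡ atom c w → v ≡ w
    atom-inj refl = refl
    ∷-inj : ∀ {n} {x y : TExp P} {xs ys : Vec (TExp P) n} → x ∷ xs ≡ y ∷ ys → (x ≡ y) × (xs ≡ ys)
    ∷-inj refl = refl , refl
    ⊓-inj : ∀ {a b c d : TExp P} → a ⊓ b ≡ c ⊓ d → (a ≡ c) × (b ≡ d)
    ⊓-inj refl = refl , refl
    ⊔-inj : ∀ {a b c d : TExp P} → a ⊔ b ≡ c ⊔ d → (a ≡ c) × (b ≡ d)
    ⊔-inj refl = refl , refl
    ¬-inj : ∀ {a b : TExp P} → ¬ᵗ a ≡ ¬ᵗ b → a ≡ b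
    ¬-inj refl = refl
    atom-injc : ∀ {c d : Sym P} {v : Vec (TExp P) (ar P c)} {w : Vec (TExp P) (ar P d)} → atom c v ≡ atom d w → c ≡ d
    atom-injc refl = refl

  mutual
    _≟ᵗ_ : DecidableEquality (TExp P)
    atom c v ≟ᵗ atom d w with c ≟ᶠ d
    ... | no c≢d = no λ e → c≢d (atom-injc e)
    ... | yes refl with ≟ᵛ v w
    ...   | yes refl = yes refl
    ...   | no v≢w = no λ e → v≢w (atom-inj e)
    atom _ _ ≟ᵗ (_ ⊓ _) = no λ ()
    atom _ _ ≟ᵗ (_ ⊔ _) = no λ ()
    atom _ _ ≟ᵗ (¬ᵗ _) = no λ ()
    atom _ _ ≟ᵗ ⊤ᵗ = no λ ()
    atom _ _ ≟ᵗ ⊥ᵗ = no λ ()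
    (_ ⊓ _) ≟ᵗ atom _ _ = no λ ()
    (a ⊓ b) ≟ᵗ (c ⊓ d) with a ≟ᵗ c | b ≟ᵗ d
    ... | yes refl | yes refl = yes refl
    ... | no p | _ = no λ e → p (proj₁ (⊓-inj e))
    ... | _ | no q = no λ e → q (proj₂ (⊓-inj e))
    (_ ⊓ _) ≟ᵗ (_ ⊔ _) = no λ ()
    (_ ⊓ _) ≟ᵗ (¬ᵗ _) = no λ ()
    (_ ⊓ _) ≟ᵗ ⊤ᵗ = no λ ()
    (_ ⊓ _) ≟ᵗ ⊥ᵗ = no λ ()
    (_ ⊔ _) ≟ᵗ atom _ _ = no λ ()
    (_ ⊔ _) ≟ᵗ (_ ⊓ _) = no λ ()
    (a ⊔ b) ≟ᵗ (c ⊔ d) with a ≟ᵗ c | b ≟ᵗ d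
    ... | yes refl | yes refl = yes refl
    ... | no p | _ = no λ e → p (proj₁ (⊔-inj e))
    ... | _ | no q = no λ e → q (proj₂ (⊔-inj e))
    (_ ⊔ _) ≟ᵗ (¬ᵗ _) = no λ ()
    (_ ⊔ _) ≟ᵗ ⊤ᵗ = no λ ()
    (_ ⊔ _) ≟ᵗ ⊥ᵗ = no λ ()
    (¬ᵗ _) ≟ᵗ atom _ _ = no λ ()
    (¬ᵗ _) ≟ᵗ (_ ⊓ _) = no λ ()
    (¬ᵗ _) ≟ᵗ (_ ⊔ _) = no λ ()
    (¬ᵗ a) ≟ᵗ (¬ᵗ b) with a ≟ᵗ b
    ... | yes refl = yes refl
    ... | no p = no λ e → p (¬-inj e)
    (¬ᵗ _) ≟ᵗ ⊤ᵗ = no λ ()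
    (¬ᵗ _) ≟ᵗ ⊥ᵗ = no λ ()
    ⊤ᵗ ≟ᵗ atom _ _ = no λ ()
    ⊤ᵗ ≟ᵗ (_ ⊓ _) = no λ ()
    ⊤ᵗ ≟ᵗ (_ ⊔ _) = no λ ()
    ⊤ᵗ ≟ᵗ (¬ᵗ _) = no λ ()
    ⊤ᵗ ≟ᵗ ⊤ᵗ = yes refl
    ⊤ᵗ ≟ᵗ ⊥ᵗ = no λ ()
    ⊥ᵗ ≟ᵗ atom _ _ = no λ ()
    ⊥ᵗ ≟ᵗ (_ ⊓ _) = no λ ()
    ⊥ᵗ ≟ᵗ (_ ⊔ _) = no λ ()
    ⊥ᵗ ≟ᵗ (¬ᵗ _) = no λ ()
    ⊥ᵗ ≟ᵗ ⊤ᵗ = no λ ()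
    ⊥ᵗ ≟ᵗ ⊥ᵗ = yes refl

    ≟ᵛ : ∀ {n} → DecidableEquality (Vec (TExp P) n)
    ≟ᵛ [] [] = yes refl
    ≟ᵛ (x ∷ xs) (y ∷ ys) with x ≟ᵗ y | ≟ᵛ xs ys
    ... | yes refl | yes refl = yes refl
    ... | no p | _ = no λ e → p (proj₁ (∷-inj e))
    ... | _ | no q = no λ e → q (proj₂ (∷-inj e))

  _≟ᵃ_ : DecidableEquality (Atom P)
  (c , v) ≟ᵃ (d , w) with atom c v ≟ᵗ atom d w
  ... | yes refl = yes refl
  ... | no p = no λ { refl → p refl }

-- Type rules  c(ζ₁,…,ζₘ) → f(τ₁,…,τₙ)
-- Parameters ζᵢ are indexed by Fin m (hence distinct);
-- each τⱼ is a parameter or d(ζ'₁,…,ζ'ₖ).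

data RArg (P : RankedAlphabet) (m : ℕ) : Set where
  par : Fin m → RArg P m
  con : (d : Sym P) → Vec (Fin m) (ar P d) → RArg P m

record Rule (S P : RankedAlphabet) : Set where
  field
    lhs  : Sym P
    sym  : Sym S
    args : Vec (RArg P (ar P lhs)) (ar S sym)
open Rule public

-- Sequences ⟨E₁,…,Eₙ⟩ (ε for n = 0) and the special sequence Λ (length 0)

data Seq (P : RankedAlphabet) : ℕ → Set where
  ⟨_⟩ : ∀ {n} → Vec (TExp P) n → Seq P n
  Λ   : Seq P 0

comp : ∀ {P n} → Seq P n → Fin n → TExp P
comp ⟨ Es ⟩ j = lookup Es j

-- push(¬⟨E₁,…,Eₖ⟩) = ⊔ₗ ⟨⊤,…,¬Eₗ,…,⊤⟩ ;  push(¬ε) = Λ   (as a list of disjuncts)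
pushNeg : ∀ {P n} → Vec (TExp P) n → List (Seq P n)
pushNeg [] = Λ ∷ []
pushNeg {n = suc n} Es@(_ ∷ _) =
  map (λ l → ⟨ replicate (suc n) ⊤ᵗ [ l ]≔ (¬ᵗ lookup Es l) ⟩) (allFin (suc n))

-- A sequence expression in the shape ⊓ᵢ (⊔ⱼ γᵢⱼ) (a list of clauses, each a list of
-- sequences); this is the shape of every B^f_C.  Its DNF is obtained by distribution.
SeqCNF : RankedAlphabet → ℕ → Set
SeqCNF P n = List (List (Seq P n))

ConjSeq : RankedAlphabet → ℕ → Set
ConjSeq P n = List (Seq P n)

dnfSeq : ∀ {P n} → SeqCNF P n → List (ConjSeq P n)
dnfSeq [] = [] ∷ []
dnfSeq (cl ∷ cls) = cartesianProductWith _∷_ cl (dnfSeq cls)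

-- Γ|ⱼ = γ₁ʲ ⊓ … ⊓ γₖʲ   (the trailing ⊤ is removed again by the DNF below)
restrict : ∀ {P n} → ConjSeq P n → Fin n → TExp P
restrict [] j = ⊤ᵗ
restrict (γ ∷ Γ) j = comp γ j ⊓ restrict Γ j

-- A conjunctive type expression, given by its (repetition-free) positive atoms and
-- complemented atoms; when pos is empty the positive literal ⊤ is present.
record Conj (P : RankedAlphabet) : Set where
  constructor mkConj
  field
    pos : List (Atom P)
    neg : List (Atom P)
open Conj public

data Lit (P : RankedAlphabet) : Set where
  topL : Lit P
  posL : Atom P → Lit P
  negL : Atom P → Lit P

lit : ∀ {P} → Conj P → List (Lit P)
lit (mkConj [] n) = topL ∷ map negL n
lit (mkConj ps@(_ ∷ _) n) = map posL ps ++ map negL n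

_⪯_ : ∀ {P} → Conj P → Conj P → Set
C₁ ⪯ C₂ = ∀ l → l ∈ lit C₂ → l ∈ lit C₁

_⊗_ : ∀ {P} → Conj P → Conj P → Conj P
mkConj p₁ n₁ ⊗ mkConj p₂ n₂ =
  mkConj (deduplicate _≟ᵃ_ (p₁ ++ p₂)) (deduplicate _≟ᵃ_ (n₁ ++ n₂))

mutual
  DNF : ∀ {P} → TExp P → List (Conj P)
  DNF (atom c σ) = mkConj ((c , σ) ∷ []) [] ∷ []
  DNF (a ⊓ b) = cartesianProductWith _⊗_ (DNF a) (DNF b)
  DNF (a ⊔ b) = DNF a ++ DNF b
  DNF (¬ᵗ a) = DNFneg a
  DNF ⊤ᵗ = mkConj [] [] ∷ []
  DNF ⊥ᵗ = []

  DNFneg : ∀ {P} → TExp P → List (Conj P)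
  DNFneg (atom c σ) = mkConj [] ((c , σ) ∷ []) ∷ []
  DNFneg (a ⊓ b) = DNFneg a ++ DNFneg b
  DNFneg (a ⊔ b) = cartesianProductWith _⊗_ (DNFneg a) (DNFneg b)
  DNFneg (¬ᵗ a) = DNF a
  DNFneg ⊤ᵗ = []
  DNFneg ⊥ᵗ = mkConj [] [] ∷ []

module Theory (S P : RankedAlphabet) (Δ : List (Rule S P)) where

  inst : ∀ {m} → Vec (TExp P) m → RArg P m → TExp P
  inst σ (par i) = lookup σ i
  inst σ (con d is) = atom d (Vec.map (lookup σ) is)

  -- right-hand sides f(E₁,…,Eₙ) of the rules ω → f(E₁,…,Eₙ) in ground(Δ), for an atom ω
  groundRule : Atom P → Rule S P → List (Σ (Sym S) λ f → Vec (TExp P) (ar S f))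
  groundRule (c , σ) r with lhs r ≟ᶠ c
  ... | yes refl = (sym r , Vec.map (inst σ) (args r)) ∷ []
  ... | no _ = []

  ground : Atom P → List (Σ (Sym S) λ f → Vec (TExp P) (ar S f))
  ground ω = concatMap (groundRule ω) Δ

  mutual
    _∈ᵗ_ : Term S → TExp P → Set
    t ∈ᵗ ⊤ᵗ = ⊤
    t ∈ᵗ ⊥ᵗ = ⊥
    t ∈ᵗ (a ⊓ b) = (t ∈ᵗ a) × (t ∈ᵗ b)
    t ∈ᵗ (a ⊔ b) = (t ∈ᵗ a) ⊎ (t ∈ᵗ b)
    t ∈ᵗ (¬ᵗ a) = ¬ (t ∈ᵗ a)
    app f ts ∈ᵗ atom c σ = memG f ts (ground (c , σ))

    memG : (f : Sym S) → Vec (Term S) (ar S f) → List (Σ (Sym S) λ g → Vec (TExp P) (ar S g)) → Set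
    memG f ts [] = ⊥
    memG f ts ((g , Es) ∷ rs) = memR f ts g Es ⊎ memG f ts rs

    memR : (f : Sym S) → Vec (Term S) (ar S f) → (g : Sym S) → Vec (TExp P) (ar S g) → Set
    memR f ts g Es with f ≟ᶠ g
    ... | yes refl = memV ts Es
    ... | no _ = ⊥

    memV : ∀ {n} → Vec (Term S) n → Vec (TExp P) n → Set
    memV [] [] = ⊤
    memV (t ∷ ts) (E ∷ Es) = (t ∈ᵗ E) × memV ts Es

  Empty : TExp P → Set
  Empty E = ∀ t → ¬ (t ∈ᵗ E)

  𝓕 : Atom P → List (Sym S)
  𝓕 α = map proj₁ (ground α)

  pick : (f : Sym S) → Σ (Sym S) (λ g → Vec (TExp P) (ar S g)) → List (Vec (TExp P) (ar S f))
  pick f (g , Es) with f ≟ᶠ g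
  ... | yes refl = Es ∷ []
  ... | no _ = []

  𝓐 : (f : Sym S) → Atom P → List (Vec (TExp P) (ar S f))
  𝓐 f α = concatMap (pick f) (ground α)

  -- 𝓑^f_C = (⊓_{ω∈pos C} ⊔𝓐^f_ω) ⊓ (⊓_{τ∈neg C} push(¬ ⊔𝓐^f_τ)),
  -- where push(¬ ⊔ᵢ γᵢ) = ⊓ᵢ push(¬γᵢ)
  𝓑 : (f : Sym S) → Conj P → SeqCNF P (ar S f)
  𝓑 f C = map (λ ω → map ⟨_⟩ (𝓐 f ω)) (pos C)
       ++ concatMap (λ τ → map pushNeg (𝓐 f τ)) (neg C)

  -- the algorithm; "X Ψ" below means "the call X(…, Ψ) returns true"
  Clash : Conj P → Set
  Clash C = ∃ λ ω → (ω ∈ pos C) × (ω ∈ neg C)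

  Covered : Conj P → List (Conj P) → Set
  Covered C Ψ = ∃ λ C' → (C' ∈ Ψ) × (C ⪯ C')

  mutual
    data EType (E : TExp P) (Ψ : List (Conj P)) : Set where
      etype : (∀ C → C ∈ DNF E → ETypeConj C Ψ) → EType E Ψ

    data ETypeConj (C : Conj P) (Ψ : List (Conj P)) : Set where
      clash   : Clash C → ETypeConj C Ψ
      covered : Covered C Ψ → ETypeConj C Ψ
      step    : ¬ Clash C → ¬ Covered C Ψ →
                (∀ f → All (λ α → f ∈ 𝓕 α) (pos C) → ESeq (𝓑 f C) (C ∷ Ψ)) →
                ETypeConj C Ψ

    data ESeq {n : ℕ} (Θ : SeqCNF P n) (Ψ : List (Conj P)) : Set where
      eseq : (∀ Γ → Γ ∈ dnfSeq Θ → ESeqConj Γ Ψ) → ESeq Θ Ψ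

    data ESeqConj : {n : ℕ} → ConjSeq P n → List (Conj P) → Set where
      lam  : ∀ {Γ : ConjSeq P 0} {Ψ} → Λ ∈ Γ → ESeqConj Γ Ψ
      some : ∀ {n} {Γ : ConjSeq P n} {Ψ} (j : Fin n) → EType (restrict Γ j) Ψ → ESeqConj Γ Ψ

  etype-true : TExp P → Set
  etype-true E = EType E []

{-# OPTIONS --safe #-}
module Submission where

-- Soundness: by induction on n, a derivation of etype(E, Ψ) shows that E has no member of
-- size ≤ n as soon as no C′ ∈ Ψ has one.  In a step for C the arguments of a member of C are
-- strictly smaller, so the emptiness of C they need is the claim itself at n − 1.
--
-- Completeness: every conjunction met while running the algorithm on E consists of atoms whose
-- arguments are subexpressions of E, hence its literals lie in a fixed finite set L.  A
-- conjunction not covered by Ψ has a trace on L different from those of Ψ, so the number of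
-- subsets of L not yet used as a trace decreases along the recursion.  The algorithm therefore
-- terminates, and a failing run assembles a member of E from the failing branches.

open import Defs
open import Data.List using (List)
open import Function.Bundles using (_⇔_)

open import Data.Bool using (true; false)
open import Data.Empty using (⊥; ⊥-elim)
open import Data.Fin using (Fin; zero; suc)
open import Data.Fin.Properties using (¬∀⟶∃¬) renaming (_≟_ to _≟ᶠ_)
open import Data.List using ([]; _∷_; _++_; map; concatMap; filter; length; allFin; deduplicate)
open import Data.List.Properties using (≡-dec)
open import Data.List.Membership.Propositional using (_∈_; _∉_; find; lose)
open import Data.List.Membership.Propositional.Properties
  using (∈-++⁺ˡ; ∈-++⁺ʳ; ∈-++⁻; ∈-map⁺; ∈-map⁻; ∈-concatMap⁺; ∈-allFin; ∈-filter⁺; ∈-filter⁻;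
         ∈-deduplicate⁺; ∈-deduplicate⁻; ∈-cartesianProductWith⁺; ∈-cartesianProductWith⁻)
import Data.List.Membership.DecPropositional as DecMembership
open import Data.List.Relation.Binary.Subset.Propositional using (_⊆_)
open import Data.List.Relation.Unary.All as All using (All; []; _∷_)
import Data.List.Relation.Unary.All.Properties as All
open import Data.List.Relation.Unary.Any as Any using (Any; here; there)
import Data.List.Relation.Unary.Any.Properties as Any
open import Data.Nat using (ℕ; zero; suc; _+_; _≤_; _<_; z≤n; s≤s)
open import Data.Nat.Induction using (<-wellFounded)
open import Data.Nat.Properties
  using (≤-refl; ≤-trans; m≤m+n; m≤n+m; n≤1+n; m≤n⇒m≤1+n; m<n⇒m<1+n)
open import Data.Product using (Σ; ∃; _×_; _,_; proj₁; proj₂; map₂; uncurry)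
open import Data.Sum using (_⊎_; inj₁; inj₂; [_,_])
import Data.Sum as Sum
open import Data.Unit using (⊤; tt)
open import Data.Vec using (Vec; []; _∷_; lookup; replicate; _[_]≔_; tabulate)
import Data.Vec as Vec
open import Data.Vec.Properties
  using (lookup∘update; lookup∘update′; lookup-replicate; lookup-map; lookup∘tabulate)
open import Function using (_∘_; const; id)
open import Function.Bundles using (mk⇔)
open import Induction.WellFounded using (Acc; acc)
open import Relation.Nullary using (¬_; Dec; yes; no; does; ¬?)
open import Relation.Nullary.Decidable using (_×-dec_; _⊎-dec_)
open import Relation.Unary using (Decidable)
open import Relation.Binary.Definitions using (DecidableEquality)
open import Relation.Binary.PropositionalEquality using (_≡_; refl; trans; subst)
import Relation.Binary.PropositionalEquality as ≡

module _ {A : Set} {P Q : A → Set} where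

  all⊎any : ∀ xs → (∀ {x} → x ∈ xs → P x ⊎ Q x) → All P xs ⊎ Any Q xs
  all⊎any []       _   = inj₁ []
  all⊎any (x ∷ xs) p⊎q with p⊎q (here refl) | all⊎any xs (p⊎q ∘ there)
  ... | inj₂ qx | _        = inj₂ (here qx)
  ... | inj₁ _  | inj₂ qxs = inj₂ (there qxs)
  ... | inj₁ px | inj₁ pxs = inj₁ (px ∷ pxs)

∀⊎∃ : ∀ {n} {P Q : Fin n → Set} → (∀ i → P i ⊎ Q i) → (∀ i → P i) ⊎ ∃ Q
∀⊎∃ p⊎q = Sum.map (λ ps i → All.lookup ps (∈-allFin i)) (map₂ proj₂ ∘ find)
                  (all⊎any (allFin _) (λ {i} _ → p⊎q i))

module _ {A : Set} where

  subsets : List A → List (List A)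
  subsets []       = [] ∷ []
  subsets (x ∷ xs) = map (x ∷_) (subsets xs) ++ subsets xs

  filter∈subsets : ∀ {P : A → Set} (P? : Decidable P) xs → filter P? xs ∈ subsets xs
  filter∈subsets P? []       = here refl
  filter∈subsets P? (x ∷ xs) with does (P? x)
  ... | true  = ∈-++⁺ˡ (∈-map⁺ (x ∷_) (filter∈subsets P? xs))
  ... | false = ∈-++⁺ʳ _ (filter∈subsets P? xs)

  vectorsOver : List A → (n : ℕ) → List (Vec A n)
  vectorsOver xs zero    = [] ∷ []
  vectorsOver xs (suc n) = concatMap (λ x → map (x ∷_) (vectorsOver xs n)) xs

  ∈-vectorsOver : ∀ xs {n} (v : Vec A n) → (∀ i → lookup v i ∈ xs) → v ∈ vectorsOver xs n
  ∈-vectorsOver xs []      _ = here refl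
  ∈-vectorsOver xs (x ∷ v) v⊆xs =
    ∈-concatMap⁺ _ (lose (v⊆xs zero) (∈-map⁺ (x ∷_) (∈-vectorsOver xs v (v⊆xs ∘ suc))))

module _ {A : Set} {P Q : A → Set} (P? : Decidable P) (Q? : Decidable Q)
         (P⇒Q : ∀ {x} → P x → Q x) where

  length-filter-mono : ∀ xs → length (filter P? xs) ≤ length (filter Q? xs)
  length-filter-mono []       = z≤n
  length-filter-mono (x ∷ xs) with P? x | Q? x
  ... | yes _  | yes _  = s≤s (length-filter-mono xs)
  ... | yes px | no ¬qx = ⊥-elim (¬qx (P⇒Q px))
  ... | no _   | yes _  = m≤n⇒m≤1+n (length-filter-mono xs)
  ... | no _   | no _   = length-filter-mono xs

  length-filter-mono-< : ∀ {x xs} → x ∈ xs → ¬ P x → Q x →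
                         length (filter P? xs) < length (filter Q? xs)
  length-filter-mono-< {xs = y ∷ xs} x∈ ¬px qx with P? y | Q? y | x∈
  ... | yes py | _      | here refl = ⊥-elim (¬px py)
  ... | no _   | no ¬qy | here refl = ⊥-elim (¬qy qx)
  ... | no _   | yes _  | here refl = s≤s (length-filter-mono xs)
  ... | yes _  | yes _  | there x∈xs = s≤s (length-filter-mono-< x∈xs ¬px qx)
  ... | yes py | no ¬qy | there _    = ⊥-elim (¬qy (P⇒Q py))
  ... | no _   | yes _  | there x∈xs = m<n⇒m<1+n (length-filter-mono-< x∈xs ¬px qx)
  ... | no _   | no _   | there x∈xs = length-filter-mono-< x∈xs ¬px qx

module Correctness (S P : RankedAlphabet) (Δ : List (Rule S P)) where
  open Theory S P Δ

  mutual
    _∈ᵗ?_ : ∀ t E → Dec (t ∈ᵗ E)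
    app f ts ∈ᵗ? atom c σ = memG? f ts (ground (c , σ))
    t ∈ᵗ? (a ⊓ b) = t ∈ᵗ? a ×-dec t ∈ᵗ? b
    t ∈ᵗ? (a ⊔ b) = t ∈ᵗ? a ⊎-dec t ∈ᵗ? b
    t ∈ᵗ? (¬ᵗ a)  = ¬? (t ∈ᵗ? a)
    t ∈ᵗ? ⊤ᵗ      = yes tt
    t ∈ᵗ? ⊥ᵗ      = no λ ()

    memG? : ∀ f ts rs → Dec (memG f ts rs)
    memG? f ts []              = no λ ()
    memG? f ts ((g , Es) ∷ rs) = memR? f ts g Es ⊎-dec memG? f ts rs

    memR? : ∀ f ts g Es → Dec (memR f ts g Es)
    memR? f ts g Es with f ≟ᶠ g
    ... | yes refl = memV? ts Es
    ... | no _     = no λ ()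

    memV? : ∀ {n} (ts : Vec (Term S) n) Es → Dec (memV ts Es)
    memV? []       []       = yes tt
    memV? (t ∷ ts) (E ∷ Es) = t ∈ᵗ? E ×-dec memV? ts Es

  memV⇒lookup : ∀ {n} {ts : Vec (Term S) n} {Es} → memV ts Es →
                ∀ i → lookup ts i ∈ᵗ lookup Es i
  memV⇒lookup {ts = _ ∷ _} {_ ∷ _} (t∈E , _)   zero    = t∈E
  memV⇒lookup {ts = _ ∷ _} {_ ∷ _} (_ , ts∈Es) (suc i) = memV⇒lookup ts∈Es i

  lookup⇒memV : ∀ {n} (ts : Vec (Term S) n) Es →
                (∀ i → lookup ts i ∈ᵗ lookup Es i) → memV ts Es
  lookup⇒memV []       []       _  = tt
  lookup⇒memV (t ∷ ts) (E ∷ Es) ∈i = ∈i zero , lookup⇒memV ts Es (∈i ∘ suc)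

  AllLits : (Atom P → Set) → (Atom P → Set) → Conj P → Set
  AllLits Pos Neg C = (∀ {ω} → ω ∈ pos C → Pos ω) × (∀ {ω} → ω ∈ neg C → Neg ω)

  private
    ∈-merge⁻ : ∀ {Q : Atom P → Set} xs {ys ω} → ω ∈ deduplicate _≟ᵃ_ (xs ++ ys) →
               (∀ {ω} → ω ∈ xs → Q ω) → (∀ {ω} → ω ∈ ys → Q ω) → Q ω
    ∈-merge⁻ xs ω∈ qxs qys = [ qxs , qys ] (∈-++⁻ xs (∈-deduplicate⁻ _≟ᵃ_ (xs ++ _) ω∈))

    ∈-mergeˡ : ∀ {xs} ys {ω : Atom P} → ω ∈ xs → ω ∈ deduplicate _≟ᵃ_ (xs ++ ys)
    ∈-mergeˡ ys ω∈ = ∈-deduplicate⁺ _≟ᵃ_ (∈-++⁺ˡ ω∈)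

    ∈-mergeʳ : ∀ xs {ys} {ω : Atom P} → ω ∈ ys → ω ∈ deduplicate _≟ᵃ_ (xs ++ ys)
    ∈-mergeʳ xs ω∈ = ∈-deduplicate⁺ _≟ᵃ_ (∈-++⁺ʳ xs ω∈)

  module _ {Pos Neg : Atom P → Set} where

    AllLits-⊗⁺ : ∀ C₁ C₂ → AllLits Pos Neg C₁ → AllLits Pos Neg C₂ →
                 AllLits Pos Neg (C₁ ⊗ C₂)
    AllLits-⊗⁺ (mkConj p₁ n₁) (mkConj p₂ n₂) (pos₁ , neg₁) (pos₂ , neg₂) =
      (λ ω∈ → ∈-merge⁻ p₁ ω∈ pos₁ pos₂) , (λ ω∈ → ∈-merge⁻ n₁ ω∈ neg₁ neg₂)

    AllLits-⊗⁻ : ∀ C₁ C₂ → AllLits Pos Neg (C₁ ⊗ C₂) →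
                 AllLits Pos Neg C₁ × AllLits Pos Neg C₂
    AllLits-⊗⁻ (mkConj p₁ n₁) (mkConj p₂ n₂) (ps , ns) =
      ((λ ω∈ → ps (∈-mergeˡ p₂ ω∈)) , (λ ω∈ → ns (∈-mergeˡ n₂ ω∈))) ,
      ((λ ω∈ → ps (∈-mergeʳ p₁ ω∈)) , (λ ω∈ → ns (∈-mergeʳ n₁ ω∈)))

  _∈ᵃ_ : Term S → Atom P → Set
  t ∈ᵃ ω = t ∈ᵗ atomExp ω

  _∈ᶜ_ : Term S → Conj P → Set
  t ∈ᶜ C = AllLits (t ∈ᵃ_) (λ ω → ¬ t ∈ᵃ ω) C

  mutual
    DNF-complete : ∀ E {t} → t ∈ᵗ E → ∃ λ C → C ∈ DNF E × t ∈ᶜ C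
    DNF-complete (atom c σ) t∈ = _ , here refl , (λ { (here refl) → t∈ }) , λ ()
    DNF-complete (a ⊓ b) (t∈a , t∈b) with DNF-complete a t∈a | DNF-complete b t∈b
    ... | C₁ , C₁∈ , t∈C₁ | C₂ , C₂∈ , t∈C₂ =
      C₁ ⊗ C₂ , ∈-cartesianProductWith⁺ _⊗_ C₁∈ C₂∈ , AllLits-⊗⁺ C₁ C₂ t∈C₁ t∈C₂
    DNF-complete (a ⊔ b) (inj₁ t∈a) with DNF-complete a t∈a
    ... | C , C∈ , t∈C = C , ∈-++⁺ˡ C∈ , t∈C
    DNF-complete (a ⊔ b) (inj₂ t∈b) with DNF-complete b t∈b
    ... | C , C∈ , t∈C = C , ∈-++⁺ʳ (DNF a) C∈ , t∈C
    DNF-complete (¬ᵗ a) t∉a = DNFneg-complete a t∉a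
    DNF-complete ⊤ᵗ _ = _ , here refl , (λ ()) , λ ()

    DNFneg-complete : ∀ E {t} → ¬ t ∈ᵗ E → ∃ λ C → C ∈ DNFneg E × t ∈ᶜ C
    DNFneg-complete (atom c σ) t∉ = _ , here refl , (λ ()) , λ { (here refl) → t∉ }
    DNFneg-complete (a ⊓ b) {t} t∉ with t ∈ᵗ? a
    ... | no t∉a with DNFneg-complete a t∉a
    ...   | C , C∈ , t∈C = C , ∈-++⁺ˡ C∈ , t∈C
    DNFneg-complete (a ⊓ b) t∉ | yes t∈a
      with DNFneg-complete b (λ t∈b → t∉ (t∈a , t∈b))
    ...   | C , C∈ , t∈C = C , ∈-++⁺ʳ (DNFneg a) C∈ , t∈C
    DNFneg-complete (a ⊔ b) t∉
      with DNFneg-complete a (t∉ ∘ inj₁) | DNFneg-complete b (t∉ ∘ inj₂)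
    ... | C₁ , C₁∈ , t∈C₁ | C₂ , C₂∈ , t∈C₂ =
      C₁ ⊗ C₂ , ∈-cartesianProductWith⁺ _⊗_ C₁∈ C₂∈ , AllLits-⊗⁺ C₁ C₂ t∈C₁ t∈C₂
    DNFneg-complete (¬ᵗ a) {t} t∉ with t ∈ᵗ? a
    ... | yes t∈a = DNF-complete a t∈a
    ... | no t∉a  = ⊥-elim (t∉ t∉a)
    DNFneg-complete ⊤ᵗ t∉ = ⊥-elim (t∉ tt)
    DNFneg-complete ⊥ᵗ _ = _ , here refl , (λ ()) , λ ()

  mutual
    DNF-sound : ∀ E {C t} → C ∈ DNF E → t ∈ᶜ C → t ∈ᵗ E
    DNF-sound (atom c σ) (here refl) (ps , _) = ps (here refl)
    DNF-sound (a ⊓ b) C∈ t∈C with ∈-cartesianProductWith⁻ _⊗_ (DNF a) (DNF b) C∈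
    ... | C₁ , C₂ , C₁∈ , C₂∈ , refl with AllLits-⊗⁻ C₁ C₂ t∈C
    ...   | t∈C₁ , t∈C₂ = DNF-sound a C₁∈ t∈C₁ , DNF-sound b C₂∈ t∈C₂
    DNF-sound (a ⊔ b) C∈ t∈C with ∈-++⁻ (DNF a) C∈
    ... | inj₁ C∈a = inj₁ (DNF-sound a C∈a t∈C)
    ... | inj₂ C∈b = inj₂ (DNF-sound b C∈b t∈C)
    DNF-sound (¬ᵗ a) C∈ t∈C = DNFneg-sound a C∈ t∈C
    DNF-sound ⊤ᵗ _ _ = tt

    DNFneg-sound : ∀ E {C t} → C ∈ DNFneg E → t ∈ᶜ C → ¬ t ∈ᵗ E
    DNFneg-sound (atom c σ) (here refl) (_ , ns) = ns (here refl)
    DNFneg-sound (a ⊓ b) C∈ t∈C (t∈a , t∈b) with ∈-++⁻ (DNFneg a) C∈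
    ... | inj₁ C∈a = DNFneg-sound a C∈a t∈C t∈a
    ... | inj₂ C∈b = DNFneg-sound b C∈b t∈C t∈b
    DNFneg-sound (a ⊔ b) C∈ t∈C t∈a⊔b
      with ∈-cartesianProductWith⁻ _⊗_ (DNFneg a) (DNFneg b) C∈
    ... | C₁ , C₂ , C₁∈ , C₂∈ , refl with AllLits-⊗⁻ C₁ C₂ t∈C | t∈a⊔b
    ...   | t∈C₁ , _ | inj₁ t∈a = DNFneg-sound a C₁∈ t∈C₁ t∈a
    ...   | _ , t∈C₂ | inj₂ t∈b = DNFneg-sound b C₂∈ t∈C₂ t∈b
    DNFneg-sound (¬ᵗ a) C∈ t∈C t∉a = t∉a (DNF-sound a C∈ t∈C)
    DNFneg-sound ⊥ᵗ _ _ ()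

  posL∈lit⁺ : ∀ (C : Conj P) {ω} → ω ∈ pos C → posL ω ∈ lit C
  posL∈lit⁺ (mkConj (_ ∷ _) _) ω∈ = ∈-++⁺ˡ (∈-map⁺ (posL {P = P}) ω∈)

  posL∈lit⁻ : ∀ (C : Conj P) {ω} → posL ω ∈ lit C → ω ∈ pos C
  posL∈lit⁻ (mkConj [] ns) (there ω∈) with ∈-map⁻ (negL {P = P}) ω∈
  ... | _ , _ , ()
  posL∈lit⁻ (mkConj ps@(_ ∷ _) ns) ω∈ with ∈-++⁻ (map (posL {P = P}) ps) ω∈
  ... | inj₁ ω∈ps with ∈-map⁻ (posL {P = P}) ω∈ps
  ...   | _ , ω∈ , refl = ω∈
  posL∈lit⁻ (mkConj ps@(_ ∷ _) ns) ω∈ | inj₂ ω∈ns with ∈-map⁻ (negL {P = P}) ω∈ns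
  ...   | _ , _ , ()

  negL∈lit⁺ : ∀ (C : Conj P) {ω} → ω ∈ neg C → negL ω ∈ lit C
  negL∈lit⁺ (mkConj []       _) ω∈ = there (∈-map⁺ (negL {P = P}) ω∈)
  negL∈lit⁺ (mkConj ps@(_ ∷ _) _) ω∈ =
    ∈-++⁺ʳ (map (posL {P = P}) ps) (∈-map⁺ (negL {P = P}) ω∈)

  negL∈lit⁻ : ∀ (C : Conj P) {ω} → negL ω ∈ lit C → ω ∈ neg C
  negL∈lit⁻ (mkConj [] ns) (there ω∈) with ∈-map⁻ (negL {P = P}) ω∈
  ... | _ , ω∈ , refl = ω∈
  negL∈lit⁻ (mkConj ps@(_ ∷ _) ns) ω∈ with ∈-++⁻ (map (posL {P = P}) ps) ω∈
  ... | inj₁ ω∈ps with ∈-map⁻ (posL {P = P}) ω∈ps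
  ...   | _ , _ , ()
  negL∈lit⁻ (mkConj ps@(_ ∷ _) ns) ω∈ | inj₂ ω∈ns with ∈-map⁻ (negL {P = P}) ω∈ns
  ...   | _ , ω∈ , refl = ω∈

  AllLits-⪯ : ∀ {Pos Neg} (C C′ : Conj P) → C ⪯ C′ → AllLits Pos Neg C → AllLits Pos Neg C′
  AllLits-⪯ C C′ C⪯C′ (ps , ns) =
    (λ ω∈ → ps (posL∈lit⁻ C (C⪯C′ _ (posL∈lit⁺ C′ ω∈)))) ,
    (λ ω∈ → ns (negL∈lit⁻ C (C⪯C′ _ (negL∈lit⁺ C′ ω∈))))

  Clash⇒∉ᶜ : ∀ {C : Conj P} {t} → Clash C → ¬ t ∈ᶜ C
  Clash⇒∉ᶜ (_ , ω∈pos , ω∈neg) (ps , ns) = ns ω∈neg (ps ω∈pos)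

  RHS : Set
  RHS = Σ (Sym S) λ g → Vec (TExp P) (ar S g)

  module _ {f : Sym S} {ts : Vec (Term S) (ar S f)} where

    memG⇒pick : ∀ (rs : List RHS) → memG f ts rs →
                ∃ λ Es → Es ∈ concatMap (pick f) rs × memV ts Es
    memG⇒pick ((g , Es) ∷ rs) (inj₁ ts∈) with f ≟ᶠ g
    ... | yes refl = Es , here refl , ts∈
    memG⇒pick ((g , Es) ∷ rs) (inj₂ ts∈) with memG⇒pick rs ts∈
    ... | Es′ , Es′∈ , ts∈Es′ = Es′ , ∈-++⁺ʳ (pick f (g , Es)) Es′∈ , ts∈Es′

    pick⇒memG : ∀ (rs : List RHS) {Es} → Es ∈ concatMap (pick f) rs → memV ts Es →
                memG f ts rs
    pick⇒memG ((g , _) ∷ rs) Es∈ ts∈ with f ≟ᶠ g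
    ... | no _ = inj₂ (pick⇒memG rs Es∈ ts∈)
    ... | yes refl with Es∈
    ...   | here refl  = inj₁ ts∈
    ...   | there Es∈′ = inj₂ (pick⇒memG rs Es∈′ ts∈)

    memG⇒head : ∀ (rs : List RHS) → memG f ts rs → f ∈ map proj₁ rs
    memG⇒head ((g , _) ∷ rs) (inj₁ ts∈) with f ≟ᶠ g
    ... | yes refl = here refl
    memG⇒head (_ ∷ rs) (inj₂ ts∈) = there (memG⇒head rs ts∈)

    ∈ᵃ⇒𝓐 : ∀ ω → app f ts ∈ᵃ ω → ∃ λ Es → Es ∈ 𝓐 f ω × memV ts Es
    ∈ᵃ⇒𝓐 ω = memG⇒pick (ground ω)

    𝓐⇒∈ᵃ : ∀ ω {Es} → Es ∈ 𝓐 f ω → memV ts Es → app f ts ∈ᵃ ω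
    𝓐⇒∈ᵃ ω = pick⇒memG (ground ω)

    ∈ᵃ⇒∈𝓕 : ∀ ω → app f ts ∈ᵃ ω → f ∈ 𝓕 ω
    ∈ᵃ⇒∈𝓕 ω = memG⇒head (ground ω)

  _∈ˢ_ : ∀ {n} → Vec (Term S) n → Seq P n → Set
  ts ∈ˢ ⟨ Es ⟩ = memV ts Es
  ts ∈ˢ Λ      = ⊥

  _∈ᶿ_ : ∀ {n} → Vec (Term S) n → SeqCNF P n → Set
  ts ∈ᶿ Θ = All (Any (ts ∈ˢ_)) Θ

  onlyAt : ∀ {n} → Fin n → TExp P → Vec (TExp P) n
  onlyAt l X = replicate _ ⊤ᵗ [ l ]≔ X

  lookup-onlyAt : ∀ {n} (l k : Fin n) X →
                  (k ≡ l × lookup (onlyAt l X) k ≡ X) ⊎ lookup (onlyAt l X) k ≡ ⊤ᵗ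
  lookup-onlyAt l k X with k ≟ᶠ l
  ... | yes refl = inj₁ (refl , lookup∘update l (replicate _ ⊤ᵗ) X)
  ... | no k≢l   =
    inj₂ (trans (lookup∘update′ k≢l (replicate _ ⊤ᵗ) X) (lookup-replicate k ⊤ᵗ))

  memV-onlyAt⁺ : ∀ {n} (ts : Vec (Term S) n) l {X} → lookup ts l ∈ᵗ X → memV ts (onlyAt l X)
  memV-onlyAt⁺ ts l {X} tₗ∈X = lookup⇒memV ts _ entry
    where
    entry : ∀ k → lookup ts k ∈ᵗ lookup (onlyAt l X) k
    entry k with lookup-onlyAt l k X
    ... | inj₁ (refl , eq) = subst (lookup ts k ∈ᵗ_) (≡.sym eq) tₗ∈X
    ... | inj₂ eq          = subst (lookup ts k ∈ᵗ_) (≡.sym eq) tt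

  memV-onlyAt⁻ : ∀ {n} {ts : Vec (Term S) n} l {X} → memV ts (onlyAt l X) → lookup ts l ∈ᵗ X
  memV-onlyAt⁻ {ts = ts} l {X} ts∈ =
    subst (lookup ts l ∈ᵗ_) (lookup∘update l (replicate _ ⊤ᵗ) X) (memV⇒lookup ts∈ l)

  pushNeg-complete : ∀ {n} (ts : Vec (Term S) n) Es → ¬ memV ts Es → Any (ts ∈ˢ_) (pushNeg Es)
  pushNeg-complete []       []            ts∉ = ⊥-elim (ts∉ tt)
  pushNeg-complete {suc n} ts Es@(_ ∷ _) ts∉
    with ¬∀⟶∃¬ (suc n) _ (λ i → lookup ts i ∈ᵗ? lookup Es i) (ts∉ ∘ lookup⇒memV ts Es)
  ... | l , tₗ∉ =
    lose (∈-map⁺ (λ l → ⟨ onlyAt l (¬ᵗ lookup Es l) ⟩) (∈-allFin l)) (memV-onlyAt⁺ ts l tₗ∉)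

  pushNeg-sound : ∀ {n} (ts : Vec (Term S) n) Es → Any (ts ∈ˢ_) (pushNeg Es) → ¬ memV ts Es
  pushNeg-sound []       []            (here ())
  pushNeg-sound {suc n} ts Es@(_ ∷ _) ts∈ with find ts∈
  ... | _ , s∈ , ts∈s
    with ∈-map⁻ (λ l → ⟨ onlyAt l (¬ᵗ lookup Es l) ⟩) {xs = allFin (suc n)} s∈
  ...   | l , _ , refl = λ ts∈Es → memV-onlyAt⁻ l ts∈s (memV⇒lookup ts∈Es l)

  𝓑-complete : ∀ {f ts} C → app f ts ∈ᶜ C → ts ∈ᶿ 𝓑 f C
  𝓑-complete {f} {ts} C (ps , ns) =
    All.++⁺ (All.map⁺ (All.tabulate posClause))
            (All.concat⁺ (All.map⁺ (All.tabulate negClauses)))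
    where
    posClause : ∀ {ω} → ω ∈ pos C → Any (ts ∈ˢ_) (map ⟨_⟩ (𝓐 f ω))
    posClause {ω} ω∈ with ∈ᵃ⇒𝓐 ω (ps ω∈)
    ... | _ , Es∈ , ts∈Es = Any.map⁺ (lose Es∈ ts∈Es)

    negClauses : ∀ {τ} → τ ∈ neg C → All (Any (ts ∈ˢ_)) (map pushNeg (𝓐 f τ))
    negClauses {τ} τ∈ = All.map⁺ (All.tabulate λ {Es} Es∈ →
      pushNeg-complete ts Es (ns τ∈ ∘ 𝓐⇒∈ᵃ τ Es∈))

  𝓑-sound : ∀ {f ts} C → ts ∈ᶿ 𝓑 f C → app f ts ∈ᶜ C
  𝓑-sound {f} {ts} C ts∈𝓑 with All.++⁻ (map (λ ω → map ⟨_⟩ (𝓐 f ω)) (pos C)) ts∈𝓑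
  ... | ts∈posClauses , ts∈negClauses = posPart , negPart
    where
    posPart : ∀ {ω} → ω ∈ pos C → app f ts ∈ᵃ ω
    posPart {ω} ω∈ with find (Any.map⁻ (All.lookup (All.map⁻ ts∈posClauses) ω∈))
    ... | _ , Es∈ , ts∈Es = 𝓐⇒∈ᵃ ω Es∈ ts∈Es

    negPart : ∀ {τ} → τ ∈ neg C → ¬ app f ts ∈ᵃ τ
    negPart {τ} τ∈ ts∈τ with ∈ᵃ⇒𝓐 τ ts∈τ
    ... | Es , Es∈ , ts∈Es = pushNeg-sound ts Es (All.lookup ts∈pushNegs Es∈) ts∈Es
      where
      ts∈pushNegs : All (λ Es → Any (ts ∈ˢ_) (pushNeg Es)) (𝓐 f τ)
      ts∈pushNegs = All.map⁻ (All.lookup (All.map⁻ (All.concat⁻ ts∈negClauses)) τ∈)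

  dnfSeq-complete : ∀ {n} {ts : Vec (Term S) n} Θ → ts ∈ᶿ Θ →
                    ∃ λ Γ → Γ ∈ dnfSeq Θ × All (ts ∈ˢ_) Γ
  dnfSeq-complete []       []            = [] , here refl , []
  dnfSeq-complete (cl ∷ Θ) (ts∈cl ∷ ts∈Θ) with find ts∈cl | dnfSeq-complete Θ ts∈Θ
  ... | s , s∈ , ts∈s | Γ , Γ∈ , ts∈Γ =
    s ∷ Γ , ∈-cartesianProductWith⁺ _∷_ s∈ Γ∈ , ts∈s ∷ ts∈Γ

  dnfSeq-sound : ∀ {n} {ts : Vec (Term S) n} Θ {Γ} → Γ ∈ dnfSeq Θ → All (ts ∈ˢ_) Γ → ts ∈ᶿ Θ
  dnfSeq-sound []       _  _ = []
  dnfSeq-sound (cl ∷ Θ) Γ∈ ts∈Γ with ∈-cartesianProductWith⁻ _∷_ cl (dnfSeq Θ) Γ∈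
  ... | _ , _ , s∈ , Γ′∈ , refl with ts∈Γ
  ...   | ts∈s ∷ ts∈Γ′ = lose s∈ ts∈s ∷ dnfSeq-sound Θ Γ′∈ ts∈Γ′

  ∈-restrict⁺ : ∀ {n} {ts : Vec (Term S) n} Γ → All (ts ∈ˢ_) Γ →
                ∀ j → lookup ts j ∈ᵗ restrict Γ j
  ∈-restrict⁺ []           []             j = tt
  ∈-restrict⁺ (⟨ Es ⟩ ∷ Γ) (ts∈Es ∷ ts∈Γ) j = memV⇒lookup ts∈Es j , ∈-restrict⁺ Γ ts∈Γ j

  ∈-restrict⁻ : ∀ {n} (ts : Vec (Term S) (suc n)) Γ →
                (∀ j → lookup ts j ∈ᵗ restrict Γ j) → All (ts ∈ˢ_) Γ
  ∈-restrict⁻ ts []           _   = []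
  ∈-restrict⁻ ts (⟨ Es ⟩ ∷ Γ) ts∈ =
    lookup⇒memV ts Es (proj₁ ∘ ts∈) ∷ ∈-restrict⁻ ts Γ (proj₂ ∘ ts∈)

  Λ∉⇒∈ : (Γ : ConjSeq P 0) → Λ ∉ Γ → All ([] ∈ˢ_) Γ
  Λ∉⇒∈ []           _  = []
  Λ∉⇒∈ (⟨ [] ⟩ ∷ Γ) Λ∉ = tt ∷ Λ∉⇒∈ Γ (Λ∉ ∘ there)
  Λ∉⇒∈ (Λ ∷ Γ)      Λ∉ = ⊥-elim (Λ∉ (here refl))

  mutual
    termSize : Term S → ℕ
    termSize (app f ts) = suc (termSizes ts)

    termSizes : ∀ {n} → Vec (Term S) n → ℕ
    termSizes []       = 0
    termSizes (t ∷ ts) = termSize t + termSizes ts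

  termSize-lookup≤termSizes : ∀ {n} (ts : Vec (Term S) n) j → termSize (lookup ts j) ≤ termSizes ts
  termSize-lookup≤termSizes (t ∷ ts) zero    = m≤m+n (termSize t) (termSizes ts)
  termSize-lookup≤termSizes (t ∷ ts) (suc j) =
    ≤-trans (termSize-lookup≤termSizes ts j) (m≤n+m (termSizes ts) (termSize t))

  EmptyUpTo : ℕ → Conj P → Set
  EmptyUpTo n C = ∀ t → termSize t ≤ n → ¬ t ∈ᶜ C

  EmptyUpTo-≤ : ∀ {m n C} → m ≤ n → EmptyUpTo n C → EmptyUpTo m C
  EmptyUpTo-≤ m≤n empty t t≤m = empty t (≤-trans t≤m m≤n)

  mutual
    EType⇒EmptyUpTo : ∀ n {E Ψ} → EType E Ψ → All (EmptyUpTo n) Ψ →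
                      ∀ t → termSize t ≤ n → ¬ t ∈ᵗ E
    EType⇒EmptyUpTo n {E} (etype ok) Ψ-empty t t≤n t∈E with DNF-complete E t∈E
    ... | C , C∈ , t∈C = ETypeConj⇒EmptyUpTo n (ok C C∈) Ψ-empty t t≤n t∈C

    ETypeConj⇒EmptyUpTo : ∀ n {C Ψ} → ETypeConj C Ψ → All (EmptyUpTo n) Ψ → EmptyUpTo n C
    ETypeConj⇒EmptyUpTo n (clash cl) _ t _ = Clash⇒∉ᶜ {t = t} cl
    ETypeConj⇒EmptyUpTo n {C} (covered (C′ , C′∈ , C⪯C′)) Ψ-empty t t≤n t∈C =
      All.lookup Ψ-empty C′∈ t t≤n (AllLits-⪯ C C′ C⪯C′ t∈C)
    ETypeConj⇒EmptyUpTo (suc n) {C} {Ψ} d@(step _ _ ok) Ψ-empty (app f ts) (s≤s ts≤n) t∈C =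
      ESeq⇒EmptyUpTo n (ok f (All.tabulate λ {ω} ω∈ → ∈ᵃ⇒∈𝓕 ω (proj₁ t∈C ω∈))) C∷Ψ-empty
        ts (λ j → ≤-trans (termSize-lookup≤termSizes ts j) ts≤n) (𝓑-complete C t∈C)
      where
      Ψ-empty′ : All (EmptyUpTo n) Ψ
      Ψ-empty′ = All.map (EmptyUpTo-≤ (n≤1+n n)) Ψ-empty

      C∷Ψ-empty : All (EmptyUpTo n) (C ∷ Ψ)
      C∷Ψ-empty = ETypeConj⇒EmptyUpTo n d Ψ-empty′ ∷ Ψ-empty′

    ESeq⇒EmptyUpTo : ∀ n {m} {Θ : SeqCNF P m} {Ψ} → ESeq Θ Ψ → All (EmptyUpTo n) Ψ →
                     ∀ ts → (∀ j → termSize (lookup ts j) ≤ n) → ¬ ts ∈ᶿ Θ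
    ESeq⇒EmptyUpTo n {Θ = Θ} (eseq ok) Ψ-empty ts ts≤n ts∈Θ with dnfSeq-complete Θ ts∈Θ
    ... | Γ , Γ∈ , ts∈Γ = ESeqConj⇒EmptyUpTo n (ok Γ Γ∈) Ψ-empty ts ts≤n ts∈Γ

    ESeqConj⇒EmptyUpTo : ∀ n {m} {Γ : ConjSeq P m} {Ψ} → ESeqConj Γ Ψ → All (EmptyUpTo n) Ψ →
                         ∀ ts → (∀ j → termSize (lookup ts j) ≤ n) → ¬ All (ts ∈ˢ_) Γ
    ESeqConj⇒EmptyUpTo n (lam Λ∈) _ _ _ ts∈Γ = All.lookup ts∈Γ Λ∈
    ESeqConj⇒EmptyUpTo n {Γ = Γ} (some j e) Ψ-empty ts ts≤n ts∈Γ =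
      EType⇒EmptyUpTo n e Ψ-empty (lookup ts j) (ts≤n j) (∈-restrict⁺ Γ ts∈Γ j)

  etype-sound : ∀ E → etype-true E → Empty E
  etype-sound E d t = EType⇒EmptyUpTo (termSize t) d [] t ≤-refl

  AtomOver : List (TExp P) → Atom P → Set
  AtomOver T (c , σ) = ∀ i → lookup σ i ∈ T

  ExpOver : List (TExp P) → TExp P → Set
  ExpOver T (atom c σ) = AtomOver T (c , σ)
  ExpOver T (a ⊓ b)    = ExpOver T a × ExpOver T b
  ExpOver T (a ⊔ b)    = ExpOver T a × ExpOver T b
  ExpOver T (¬ᵗ a)     = ExpOver T a
  ExpOver T ⊤ᵗ         = ⊤
  ExpOver T ⊥ᵗ         = ⊤

  mutual
    subexpressions : TExp P → List (TExp P)
    subexpressions E@(atom c σ) = E ∷ subexpressionsᵛ σ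
    subexpressions E@(a ⊓ b)    = E ∷ subexpressions a ++ subexpressions b
    subexpressions E@(a ⊔ b)    = E ∷ subexpressions a ++ subexpressions b
    subexpressions E@(¬ᵗ a)     = E ∷ subexpressions a
    subexpressions ⊤ᵗ           = ⊤ᵗ ∷ []
    subexpressions ⊥ᵗ           = ⊥ᵗ ∷ []

    subexpressionsᵛ : ∀ {n} → Vec (TExp P) n → List (TExp P)
    subexpressionsᵛ []       = []
    subexpressionsᵛ (E ∷ Es) = subexpressions E ++ subexpressionsᵛ Es

  E∈subexpressions : ∀ E → E ∈ subexpressions E
  E∈subexpressions (atom _ _) = here refl
  E∈subexpressions (_ ⊓ _)    = here refl
  E∈subexpressions (_ ⊔ _)    = here refl
  E∈subexpressions (¬ᵗ _)     = here refl
  E∈subexpressions ⊤ᵗ         = here refl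
  E∈subexpressions ⊥ᵗ         = here refl

  lookup∈subexpressionsᵛ : ∀ {n} (Es : Vec (TExp P) n) i → lookup Es i ∈ subexpressionsᵛ Es
  lookup∈subexpressionsᵛ (E ∷ _)  zero    = ∈-++⁺ˡ (E∈subexpressions E)
  lookup∈subexpressionsᵛ (E ∷ Es) (suc i) =
    ∈-++⁺ʳ (subexpressions E) (lookup∈subexpressionsᵛ Es i)

  mutual
    subexpressions-⊆ : ∀ E {X} → X ∈ subexpressions E → subexpressions X ⊆ subexpressions E
    subexpressions-⊆ (atom c σ) (here refl) = id
    subexpressions-⊆ (atom c σ) (there X∈) = there ∘ subexpressionsᵛ-⊆ σ X∈
    subexpressions-⊆ (a ⊓ b)    (here refl) = id
    subexpressions-⊆ (a ⊓ b)    (there X∈) = there ∘ subexpressions₂-⊆ a b X∈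
    subexpressions-⊆ (a ⊔ b)    (here refl) = id
    subexpressions-⊆ (a ⊔ b)    (there X∈) = there ∘ subexpressions₂-⊆ a b X∈
    subexpressions-⊆ (¬ᵗ a)     (here refl) = id
    subexpressions-⊆ (¬ᵗ a)     (there X∈) = there ∘ subexpressions-⊆ a X∈
    subexpressions-⊆ ⊤ᵗ         (here refl) = id
    subexpressions-⊆ ⊥ᵗ         (here refl) = id

    subexpressions₂-⊆ : ∀ a b {X} → X ∈ subexpressions a ++ subexpressions b →
                        subexpressions X ⊆ subexpressions a ++ subexpressions b
    subexpressions₂-⊆ a b X∈ with ∈-++⁻ (subexpressions a) X∈
    ... | inj₁ X∈a = ∈-++⁺ˡ ∘ subexpressions-⊆ a X∈a
    ... | inj₂ X∈b = ∈-++⁺ʳ (subexpressions a) ∘ subexpressions-⊆ b X∈b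

    subexpressionsᵛ-⊆ : ∀ {n} (Es : Vec (TExp P) n) {X} → X ∈ subexpressionsᵛ Es →
                        subexpressions X ⊆ subexpressionsᵛ Es
    subexpressionsᵛ-⊆ (E ∷ Es) X∈ with ∈-++⁻ (subexpressions E) X∈
    ... | inj₁ X∈E  = ∈-++⁺ˡ ∘ subexpressions-⊆ E X∈E
    ... | inj₂ X∈Es = ∈-++⁺ʳ (subexpressions E) ∘ subexpressionsᵛ-⊆ Es X∈Es

  subexpressions-closed : ∀ E {X} → X ∈ subexpressions E → ExpOver (subexpressions E) X
  subexpressions-closed E {atom c σ} X∈ i =
    subexpressions-⊆ E X∈ (there (lookup∈subexpressionsᵛ σ i))
  subexpressions-closed E {a ⊓ b} X∈ =
    subexpressions-closed E (subexpressions-⊆ E X∈ (there (∈-++⁺ˡ (E∈subexpressions a)))) ,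
    subexpressions-closed E
      (subexpressions-⊆ E X∈ (there (∈-++⁺ʳ (subexpressions a) (E∈subexpressions b))))
  subexpressions-closed E {a ⊔ b} X∈ =
    subexpressions-closed E (subexpressions-⊆ E X∈ (there (∈-++⁺ˡ (E∈subexpressions a)))) ,
    subexpressions-closed E
      (subexpressions-⊆ E X∈ (there (∈-++⁺ʳ (subexpressions a) (E∈subexpressions b))))
  subexpressions-closed E {¬ᵗ a} X∈ =
    subexpressions-closed E (subexpressions-⊆ E X∈ (there (E∈subexpressions a)))
  subexpressions-closed E {⊤ᵗ} _ = tt
  subexpressions-closed E {⊥ᵗ} _ = tt

  _≟ˡ_ : DecidableEquality (Lit P)
  topL   ≟ˡ topL   = yes refl
  topL   ≟ˡ posL _ = no λ ()
  topL   ≟ˡ negL _ = no λ ()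
  posL _ ≟ˡ topL   = no λ ()
  posL ω ≟ˡ posL υ with ω ≟ᵃ υ
  ... | yes refl = yes refl
  ... | no ω≢υ   = no λ { refl → ω≢υ refl }
  posL _ ≟ˡ negL _ = no λ ()
  negL _ ≟ˡ topL   = no λ ()
  negL _ ≟ˡ posL _ = no λ ()
  negL ω ≟ˡ negL υ with ω ≟ᵃ υ
  ... | yes refl = yes refl
  ... | no ω≢υ   = no λ { refl → ω≢υ refl }

  open DecMembership _≟ˡ_ using () renaming (_∈?_ to _∈ˡ?_)
  open DecMembership (_≟ᵃ_ {P = P}) using () renaming (_∈?_ to _∈ᵃ?_)

  clash? : ∀ C → Dec (Clash C)
  clash? C with Any.any? (λ ω → ω ∈ᵃ? neg C) (pos C)
  ... | yes ∃ω = yes (find ∃ω)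
  ... | no ¬∃ω = no λ (_ , ω∈pos , ω∈neg) → ¬∃ω (lose ω∈pos ω∈neg)

  _⪯?_ : ∀ C C′ → Dec (C ⪯ C′)
  C ⪯? C′ with All.all? (_∈ˡ? lit C) (lit C′)
  ... | yes ⊇ = yes λ _ l∈ → All.lookup ⊇ l∈
  ... | no ⊉  = no λ C⪯C′ → ⊉ (All.tabulate (C⪯C′ _))

  covered? : ∀ C Ψ → Dec (Covered C Ψ)
  covered? C Ψ with Any.any? (C ⪯?_) Ψ
  ... | yes cov = yes (find cov)
  ... | no ¬cov = no λ (_ , C′∈ , C⪯C′) → ¬cov (lose C′∈ C⪯C′)

  module Completeness (T : List (TExp P)) (T-closed : ∀ {X} → X ∈ T → ExpOver T X) where

    open DecMembership (≡-dec _≟ˡ_) using (_∉?_)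

    ConjOver : Conj P → Set
    ConjOver = AllLits (AtomOver T) (AtomOver T)

    VecOver : ∀ {n} → Vec (TExp P) n → Set
    VecOver Es = ∀ i → ExpOver T (lookup Es i)

    SeqOver : ∀ {n} → Seq P n → Set
    SeqOver ⟨ Es ⟩ = VecOver Es
    SeqOver Λ      = ⊤

    mutual
      DNF-over : ∀ E {C} → ExpOver T E → C ∈ DNF E → ConjOver C
      DNF-over (atom c σ) σ⊆T (here refl) = (λ { (here refl) → σ⊆T }) , λ ()
      DNF-over (a ⊓ b) (a-over , b-over) C∈
        with ∈-cartesianProductWith⁻ _⊗_ (DNF a) (DNF b) C∈
      ... | C₁ , C₂ , C₁∈ , C₂∈ , refl =
        AllLits-⊗⁺ C₁ C₂ (DNF-over a a-over C₁∈) (DNF-over b b-over C₂∈)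
      DNF-over (a ⊔ b) (a-over , b-over) C∈ with ∈-++⁻ (DNF a) C∈
      ... | inj₁ C∈a = DNF-over a a-over C∈a
      ... | inj₂ C∈b = DNF-over b b-over C∈b
      DNF-over (¬ᵗ a) a-over C∈ = DNFneg-over a a-over C∈
      DNF-over ⊤ᵗ _ (here refl) = (λ ()) , λ ()

      DNFneg-over : ∀ E {C} → ExpOver T E → C ∈ DNFneg E → ConjOver C
      DNFneg-over (atom c σ) σ⊆T (here refl) = (λ ()) , λ { (here refl) → σ⊆T }
      DNFneg-over (a ⊓ b) (a-over , b-over) C∈ with ∈-++⁻ (DNFneg a) C∈
      ... | inj₁ C∈a = DNFneg-over a a-over C∈a
      ... | inj₂ C∈b = DNFneg-over b b-over C∈b
      DNFneg-over (a ⊔ b) (a-over , b-over) C∈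
        with ∈-cartesianProductWith⁻ _⊗_ (DNFneg a) (DNFneg b) C∈
      ... | C₁ , C₂ , C₁∈ , C₂∈ , refl =
        AllLits-⊗⁺ C₁ C₂ (DNFneg-over a a-over C₁∈) (DNFneg-over b b-over C₂∈)
      DNFneg-over (¬ᵗ a) a-over C∈ = DNF-over a a-over C∈
      DNFneg-over ⊥ᵗ _ (here refl) = (λ ()) , λ ()

    inst-over : ∀ {m} {σ : Vec (TExp P) m} → (∀ i → lookup σ i ∈ T) →
                ∀ a → ExpOver T (inst σ a)
    inst-over σ⊆T (par i)     = T-closed (σ⊆T i)
    inst-over σ⊆T (con d is) k = subst (_∈ T) (≡.sym (lookup-map k _ is)) (σ⊆T (lookup is k))

    groundRule-over : ∀ {c σ} → AtomOver T (c , σ) →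
                      ∀ r → All (VecOver ∘ proj₂) (groundRule (c , σ) r)
    groundRule-over {c} {σ} σ⊆T r with lhs r ≟ᶠ c
    ... | no _     = []
    ... | yes refl = args-over ∷ []
      where
      args-over : VecOver (Vec.map (inst σ) (args r))
      args-over k = subst (ExpOver T) (≡.sym (lookup-map k (inst σ) (args r)))
                          (inst-over σ⊆T (lookup (args r) k))

    pick-over : ∀ f (r : RHS) → VecOver (proj₂ r) → All VecOver (pick f r)
    pick-over f (g , Es) Es-over with f ≟ᶠ g
    ... | yes refl = Es-over ∷ []
    ... | no _     = []

    𝓐-over : ∀ f ω → AtomOver T ω → All VecOver (𝓐 f ω)
    𝓐-over f (c , σ) σ⊆T = All.concat⁺ (All.map⁺ (All.map (pick-over f _) ground-over))
      where
      ground-over : All (VecOver ∘ proj₂) (ground (c , σ))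
      ground-over = All.concat⁺ (All.map⁺ (All.universal (groundRule-over σ⊆T) Δ))

    pushNeg-over : ∀ {n} (Es : Vec (TExp P) n) → VecOver Es → All SeqOver (pushNeg Es)
    pushNeg-over []          _       = tt ∷ []
    pushNeg-over Es@(_ ∷ _) Es-over =
      All.map⁺ {f = λ l → ⟨ onlyAt l (¬ᵗ lookup Es l) ⟩} (All.universal onlyAt-over (allFin _))
      where
      onlyAt-over : ∀ l k → ExpOver T (lookup (onlyAt l (¬ᵗ lookup Es l)) k)
      onlyAt-over l k with lookup-onlyAt l k (¬ᵗ lookup Es l)
      ... | inj₁ (refl , eq) = subst (ExpOver T) (≡.sym eq) (Es-over l)
      ... | inj₂ eq          = subst (ExpOver T) (≡.sym eq) tt

    𝓑-over : ∀ {C} → ConjOver C → ∀ f → All (All SeqOver) (𝓑 f C)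
    𝓑-over (ps , ns) f =
      All.++⁺ (All.map⁺ (All.tabulate λ {ω} ω∈ → All.map⁺ (𝓐-over f ω (ps ω∈))))
              (All.concat⁺ (All.map⁺ (All.tabulate λ {τ} τ∈ →
                All.map⁺ (All.map (λ {Es} → pushNeg-over Es) (𝓐-over f τ (ns τ∈))))))

    dnfSeq-over : ∀ {n} {Θ : SeqCNF P n} → All (All SeqOver) Θ →
                  ∀ {Γ} → Γ ∈ dnfSeq Θ → All SeqOver Γ
    dnfSeq-over {Θ = []}     []                 (here refl) = []
    dnfSeq-over {Θ = cl ∷ Θ} (cl-over ∷ Θ-over) Γ∈
      with ∈-cartesianProductWith⁻ _∷_ cl (dnfSeq Θ) Γ∈
    ... | _ , _ , s∈ , Γ′∈ , refl = All.lookup cl-over s∈ ∷ dnfSeq-over Θ-over Γ′∈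

    restrict-over : ∀ {n} {Γ : ConjSeq P n} → All SeqOver Γ → ∀ j → ExpOver T (restrict Γ j)
    restrict-over {Γ = []}        []                 j = tt
    restrict-over {Γ = ⟨ _ ⟩ ∷ _} (Es-over ∷ Γ-over) j = Es-over j , restrict-over Γ-over j

    atomsOver : List (Atom P)
    atomsOver = concatMap (λ c → map (c ,_) (vectorsOver T (ar P c))) (allFin (size P))

    ∈-atomsOver : ∀ {ω} → AtomOver T ω → ω ∈ atomsOver
    ∈-atomsOver {c , σ} σ⊆T =
      ∈-concatMap⁺ _ (lose (∈-allFin c) (∈-map⁺ (c ,_) (∈-vectorsOver T σ σ⊆T)))

    literalsOver : List (Lit P)
    literalsOver = topL ∷ map posL atomsOver ++ map negL atomsOver

    lit⊆literalsOver : ∀ C → ConjOver C → lit C ⊆ literalsOver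
    lit⊆literalsOver C _        {topL}   _  = here refl
    lit⊆literalsOver C (ps , _) {posL ω} l∈ =
      there (∈-++⁺ˡ (∈-map⁺ (posL {P = P}) (∈-atomsOver (ps (posL∈lit⁻ C l∈)))))
    lit⊆literalsOver C (_ , ns) {negL ω} l∈ =
      there (∈-++⁺ʳ (map posL atomsOver)
                    (∈-map⁺ (negL {P = P}) (∈-atomsOver (ns (negL∈lit⁻ C l∈)))))

    trace : Conj P → List (Lit P)
    trace C = filter (_∈ˡ? lit C) literalsOver

    trace-≡⇒⪯ : ∀ C {C′} → ConjOver C′ → trace C ≡ trace C′ → C ⪯ C′
    trace-≡⇒⪯ C {C′} C′-over eq l l∈C′ =
      proj₂ (∈-filter⁻ (_∈ˡ? lit C) (subst (l ∈_) (≡.sym eq)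
        (∈-filter⁺ (_∈ˡ? lit C′) (lit⊆literalsOver C′ C′-over l∈C′) l∈C′)))

    unexplored : List (Conj P) → ℕ
    unexplored Ψ = length (filter (_∉? map trace Ψ) (subsets literalsOver))

    unexplored-∷-< : ∀ {C Ψ} → All ConjOver Ψ → ¬ Covered C Ψ →
                     unexplored (C ∷ Ψ) < unexplored Ψ
    unexplored-∷-< {C} {Ψ} Ψ-over ¬cov =
      length-filter-mono-< (_∉? map trace (C ∷ Ψ)) (_∉? map trace Ψ) (_∘ there)
        (filter∈subsets (_∈ˡ? lit C) literalsOver) (λ ∉ → ∉ (here refl)) new
      where
      new : trace C ∉ map trace Ψ
      new tr∈ with ∈-map⁻ trace tr∈
      ... | C′ , C′∈ , eq = ¬cov (C′ , C′∈ , trace-≡⇒⪯ C (All.lookup Ψ-over C′∈) eq)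

    isΛ? : (s : Seq P 0) → Dec (Λ ≡ s)
    isΛ? ⟨ [] ⟩ = no λ ()
    isΛ? Λ      = yes refl

    mutual
      decide : ∀ {Ψ} → Acc _<_ (unexplored Ψ) → All ConjOver Ψ →
               ∀ E → ExpOver T E → EType E Ψ ⊎ ∃ (_∈ᵗ E)
      decide rec Ψ-over E E-over =
        Sum.map (λ ok → etype λ _ C∈ → All.lookup ok C∈) witness
          (all⊎any (DNF E) λ C∈ → decideConj rec Ψ-over _ (DNF-over E E-over C∈))
        where
        witness : Any (λ C → ∃ (_∈ᶜ C)) (DNF E) → ∃ (_∈ᵗ E)
        witness any with find any
        ... | _ , C∈ , t , t∈C = t , DNF-sound E C∈ t∈C

      decideConj : ∀ {Ψ} → Acc _<_ (unexplored Ψ) → All ConjOver Ψ →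
                   ∀ C → ConjOver C → ETypeConj C Ψ ⊎ ∃ (_∈ᶜ C)
      decideConj {Ψ} (acc rs) Ψ-over C C-over with clash? C | covered? C Ψ
      ... | yes cl | _       = inj₁ (clash cl)
      ... | no _   | yes cov = inj₁ (covered cov)
      ... | no ¬cl | no ¬cov =
        Sum.map (step ¬cl ¬cov) proj₂
          (∀⊎∃ (decideSymbol (rs (unexplored-∷-< {C} Ψ-over ¬cov)) (C-over ∷ Ψ-over) C C-over))

      decideSymbol : ∀ {Ψ} → Acc _<_ (unexplored Ψ) → All ConjOver Ψ → ∀ C → ConjOver C → ∀ f →
                  (All (λ α → f ∈ 𝓕 α) (pos C) → ESeq (𝓑 f C) Ψ) ⊎ ∃ (_∈ᶜ C)
      decideSymbol rec Ψ-over C C-over f =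
        Sum.map const (λ (ts , ts∈) → app f ts , 𝓑-sound C ts∈)
          (decideSeqs rec Ψ-over (𝓑 f C) (𝓑-over C-over f))

      decideSeqs : ∀ {Ψ} → Acc _<_ (unexplored Ψ) → All ConjOver Ψ →
                   ∀ {n} (Θ : SeqCNF P n) → All (All SeqOver) Θ → ESeq Θ Ψ ⊎ ∃ (_∈ᶿ Θ)
      decideSeqs rec Ψ-over Θ Θ-over =
        Sum.map (λ ok → eseq λ _ Γ∈ → All.lookup ok Γ∈) witness
          (all⊎any (dnfSeq Θ) λ Γ∈ → decideSeqConj rec Ψ-over _ (dnfSeq-over Θ-over Γ∈))
        where
        witness : Any (λ Γ → ∃ λ ts → All (ts ∈ˢ_) Γ) (dnfSeq Θ) → ∃ (_∈ᶿ Θ)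
        witness any with find any
        ... | _ , Γ∈ , ts , ts∈Γ = ts , dnfSeq-sound Θ Γ∈ ts∈Γ

      decideSeqConj : ∀ {Ψ} → Acc _<_ (unexplored Ψ) → All ConjOver Ψ →
                      ∀ {n} (Γ : ConjSeq P n) → All SeqOver Γ →
                      ESeqConj Γ Ψ ⊎ ∃ λ ts → All (ts ∈ˢ_) Γ
      decideSeqConj _ _ {zero} Γ _ with Any.any? isΛ? Γ
      ... | yes Λ∈ = inj₁ (lam Λ∈)
      ... | no Λ∉  = inj₂ ([] , Λ∉⇒∈ Γ Λ∉)
      decideSeqConj rec Ψ-over {suc n} Γ Γ-over =
        Sum.swap (Sum.map witness (uncurry some)
          (∀⊎∃ λ j → Sum.swap (decide rec Ψ-over (restrict Γ j) (restrict-over Γ-over j))))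
        where
        witness : (∀ j → ∃ (_∈ᵗ restrict Γ j)) → ∃ λ ts → All (ts ∈ˢ_) Γ
        witness ∈j = tabulate (proj₁ ∘ ∈j) , ∈-restrict⁻ _ Γ λ j →
          subst (_∈ᵗ restrict Γ j) (≡.sym (lookup∘tabulate (proj₁ ∘ ∈j) j)) (proj₂ (∈j j))

    completeness : ∀ {E} → ExpOver T E → Empty E → etype-true E
    completeness {E} E-over empty =
      [ id , (λ (t , t∈E) → ⊥-elim (empty t t∈E)) ] (decide (<-wellFounded _) [] E E-over)

  etype-complete : ∀ E → Empty E → etype-true E
  etype-complete E = Completeness.completeness (subexpressions E) (subexpressions-closed E)
                       (subexpressions-closed E (E∈subexpressions E))

-- Neither direction uses the constant of Σ.
theorem1 : (S P : RankedAlphabet) → HasConstant S → (Δ : List (Rule S P)) → (E : TExp P) →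
    Theory.etype-true S P Δ E ⇔ Theory.Empty S P Δ E
theorem1 S P _ Δ E = mk⇔ (etype-sound E) (etype-complete E)
  where open Correctness S P Δ
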